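{- Let $F$ be a generalised multi-clause-set. (1) The maximal value of $c(F')$ over matching satisfiable sub-multi-clause-sets $F'\le F$ equals $c(F)-\delta^*(F)$. (2) $F$ is matching satisfiable if and only if $\delta^*(F)=0$.
   Context: Each variable $v$ has a finite non-empty domain $D_v$; a literal is a pair $(v,\varepsilon)$, $\varepsilon\in D_v$; a clause is a finite set of literals with no two distinct literals on the same variable; a multi-clause-set $F$ is a finitely supported map from clauses to $\mathbb{N}_0$, $F'\le F$ meaning $F'(C)\le F(C)$ for all $C$, and $F_1+F_2$ pointwise sum. $c(F)=\sum_CF(C)$, $\mathrm{rd}(F)=\sum_{v\in\mathrm{var}(F)}(|D_v|-1)$, $\delta(F)=c(F)-\mathrm{rd}(F)$, $\delta^*(F)=\max_{F'\le F}\delta(F')$. $F$ is matching satisfiable if there is a decomposition $F=F_1+\dots+F_m$ ($m\in\mathbb{N}_0$) and pairwise distinct variables $v_1,\dots,v_m$ such that, for each $i$, $v_i\in\mathrm{var}(C)$ for every clause $C$ of $F_i$ and $|D_{v_i}|>c(F_i)$. -}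

module Defs where

open import Data.Nat as ℕ using (ℕ; _<_; _∸_)
open import Data.Integer as ℤ using (ℤ; +_; _-_; _⊔_)
open import Data.Fin using (Fin)
open import Data.Product using (Σ; _×_; proj₁; proj₂; ∃-syntax)
open import Data.List using (List; []; _∷_; map; length; concat; concatMap; deduplicate)
open import Data.Nat.ListAction using (sum)
open import Data.List.Membership.Propositional using (_∈_)
open import Data.List.Relation.Unary.All using (All)
open import Data.List.Relation.Unary.Unique.Propositional using (Unique)
open import Data.List.Relation.Binary.Sublist.Propositional using (_⊆_)
open import Data.List.Relation.Binary.Permutation.Propositional using (_↭_)

-- Variables are natural numbers; d v = |D_v| is the size of the domain of v,
-- and the domain D_v is represented by Fin (d v).
module _ (d : ℕ → ℕ) where

  Literal : Set
  Literal = Σ ℕ (λ v → Fin (d v))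

  record Clause : Set where
    constructor clause
    field
      lits   : List Literal
      unique : Unique (map proj₁ lits)
  open Clause public

  varC : Clause → List ℕ
  varC C = map proj₁ (lits C)

  -- multi-clause-sets: finite multisets of clauses, represented by lists
  -- (multiset equality = permutation _↭_)
  MCS : Set
  MCS = List Clause

  _≤ₘ_ : MCS → MCS → Set
  F' ≤ₘ F = ∃[ G ] (G ⊆ F × F' ↭ G)

  c : MCS → ℕ
  c = length

  varF : MCS → List ℕ
  varF F = deduplicate ℕ._≟_ (concatMap varC F)

  rd : MCS → ℕ
  rd F = sum (map (λ v → d v ∸ 1) (varF F))

  δ : MCS → ℤ
  δ F = + c F - + rd F

  -- all sub-lists of a list (= all sub-multisets, up to permutation)
  subs : {A : Set} → List A → List (List A)
  subs []       = [] ∷ []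
  subs (x ∷ xs) = subs xs Data.List.++ map (x ∷_) (subs xs)

  maxℤ : List ℤ → ℤ → ℤ
  maxℤ []       a = a
  maxℤ (x ∷ xs) a = maxℤ xs (x ⊔ a)

  -- δ*(F) = max_{F' ≤ F} δ(F'); the empty sub-multiset has δ = 0
  δ* : MCS → ℤ
  δ* F = maxℤ (map δ (subs F)) (δ [])

  -- matching satisfiability: F = F_1 + ... + F_m with pairwise distinct v_i,
  -- v_i ∈ var(C) for all clauses C of F_i, and |D_{v_i}| > c(F_i)
  MatchingSat : MCS → Set
  MatchingSat F =
    ∃[ ps ] ( concat (map proj₂ ps) ↭ F
            × Unique (map proj₁ ps)
            × All (λ (p : ℕ × MCS) →
                     All (λ C → proj₁ p ∈ varC C) (proj₂ p)
                     × c (proj₂ p) < d (proj₁ p)) ps )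

module Submission where

-- Read F as a bipartite graph between clauses and variables, a clause C being adjacent to var(C), and
-- give each variable v the capacity |D_v| − 1. A matching satisfiable F' ≤ F is then a capacitated
-- matching, and δ(H) = |H| − Σ_{v ∈ var(H)} (|D_v| − 1) is the deficiency of H, so (1) is the deficiency
-- form of Hall's theorem for capacitated matchings and (2) its case of a perfect matching.
--
-- Every matching M and every H ≤ F satisfy |M| ≤ c(F) − δ(H): the clauses of H that M matches sit at
-- variables of var(H). Conversely, by induction on F and for all capacities at once, there are M and a
-- "tight" H with |M| + δ(H) ≥ c(F). To add a clause C, go through its variables v of positive capacity
-- and take the solution (M_v, H_v) for the capacity lowered by one at v. If v ∉ var(H_v), or M_v is not
-- smaller than the old matching, C can be matched to v. Otherwise H_v is tight for the old matching too,
-- and since δ is supermodular and bounded by the matching, a union of tight sets is tight. If C is never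
-- matched, the union of all these H_v contains every usable variable of C, so adding C to it raises its
-- deficiency by one.

open import Defs
open import Data.Nat as ℕ using (ℕ; zero; suc; _+_; _∸_; _≤_; _<_; z≤n; s≤s; _≤?_)
open import Data.Nat.Properties as ℕ using (≤-refl; ≤-trans; +-mono-≤; +-monoʳ-≤; +-monoˡ-≤; +-comm; +-assoc; +-suc; module ≤-Reasoning)
open import Data.Nat.ListAction using (sum)
open import Algebra.Properties.CommutativeSemigroup ℕ.+-commutativeSemigroup using (interchange)
open import Data.Bool using (Bool; true; false; if_then_else_; _∨_; _∧_)
open import Data.Empty using (⊥-elim)
open import Data.Integer as ℤ using (+_; _-_; _⊔_; +≤+)
import Data.Integer.Properties as ℤ
open import Data.Integer.Tactic.RingSolver using (solve-∀)
open import Data.List using (List; []; _∷_; [_]; map; length; concat; concatMap; filter; deduplicate)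
open import Data.List.Properties using (map-cong-local; length-++; filter-++; filter-all; filter-none; length-filter)
open import Data.List.Membership.Propositional using (_∈_; _∉_; find; lose)
open import Data.List.Membership.Propositional.Properties
  using (∈-concatMap⁺; ∈-concatMap⁻; ∈-map⁺; ∈-map⁻; ∈-++⁺ˡ; ∈-++⁺ʳ; ∈-++⁻; ∈-deduplicate⁺; ∈-deduplicate⁻)
open import Data.List.Membership.DecPropositional ℕ._≟_ using (_∈?_)
open import Data.List.Relation.Binary.Pointwise using (Pointwise-≡⇒≡)
open import Data.List.Relation.Binary.Permutation.Propositional using (_↭_; ↭-refl; ↭-trans; ↭-sym; prep)
open import Data.List.Relation.Binary.Permutation.Propositional.Properties using (++⁺ˡ; shift; filter-↭; ↭-length)
import Data.List.Relation.Binary.Sublist.Propositional as Sublist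
open import Data.List.Relation.Binary.Sublist.Propositional using ([]; _∷_; _∷ʳ_)
open import Data.List.Relation.Binary.Sublist.Propositional.Properties using (filter⁺; length-mono-≤; []⊆-universal; to-≋)
open import Data.List.Relation.Binary.Subset.Propositional using (_⊆_)
open import Data.List.Relation.Binary.Subset.DecPropositional ℕ._≟_ using (_⊆?_)
open import Data.List.Relation.Unary.All as All using (All; []; _∷_)
open import Data.List.Relation.Unary.All.Properties using (All¬⇒¬Any)
open import Data.List.Relation.Unary.AllPairs using ([]; _∷_)
open import Data.List.Relation.Unary.Any using (here; there)
open import Data.List.Relation.Unary.Unique.Propositional using (Unique)
open import Data.List.Relation.Unary.Unique.DecPropositional.Properties ℕ._≟_ using (deduplicate-!)
open import Data.Product using (Σ-syntax; ∃-syntax; _×_; _,_; proj₁; proj₂)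
open import Data.Sum using (_⊎_; inj₁; inj₂)
import Data.Sum as Sum
open import Function using (_∘_; id)
open import Function.Bundles using (_⇔_; mk⇔; Equivalence)
open import Relation.Binary.PropositionalEquality using (_≡_; refl; sym; trans; cong; cong₂; subst; module ≡-Reasoning)
open import Relation.Nullary using (yes; no; does; ¬_)

sumMap : List ℕ → (ℕ → ℕ) → ℕ
sumMap L f = sum (map f L)

infixl 7 _↾_

_↾_ : (ℕ → ℕ) → List ℕ → ℕ → ℕ
(f ↾ X) v = if does (v ∈? X) then f v else 0

sumMap-mono : ∀ L {f g} → (∀ v → f v ≤ g v) → sumMap L f ≤ sumMap L g
sumMap-mono []      f≤g = z≤n
sumMap-mono (x ∷ L) f≤g = +-mono-≤ (f≤g x) (sumMap-mono L f≤g)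

sumMap-cong : ∀ L {f g} → All (λ v → f v ≡ g v) L → sumMap L f ≡ sumMap L g
sumMap-cong L f≡g = cong sum (map-cong-local f≡g)

sumMap-+ : ∀ L f g → sumMap L (λ v → f v + g v) ≡ sumMap L f + sumMap L g
sumMap-+ []      f g = refl
sumMap-+ (x ∷ L) f g rewrite sumMap-+ L f g = interchange (f x) (g x) (sumMap L f) (sumMap L g)

sumMap-↾-empty : ∀ L f → sumMap L (f ↾ []) ≡ 0
sumMap-↾-empty []      f = refl
sumMap-↾-empty (x ∷ L) f = sumMap-↾-empty L f

module _ (f : ℕ → ℕ) {v : ℕ} where

  ↾-∈ : ∀ {X} → v ∈ X → (f ↾ X) v ≡ f v
  ↾-∈ {X} v∈X with v ∈? X
  ... | yes _   = refl
  ... | no  v∉X = ⊥-elim (v∉X v∈X)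

  ↾-∉ : ∀ {X} → v ∉ X → (f ↾ X) v ≡ 0
  ↾-∉ {X} v∉X with v ∈? X
  ... | yes v∈X = ⊥-elim (v∉X v∈X)
  ... | no  _   = refl

  ↾-≤ : ∀ X → (f ↾ X) v ≤ f v
  ↾-≤ X with v ∈? X
  ... | yes _ = ≤-refl
  ... | no  _ = z≤n

  ↾-cong : ∀ {X Y} → (v ∈ X → v ∈ Y) → (v ∈ Y → v ∈ X) → (f ↾ X) v ≡ (f ↾ Y) v
  ↾-cong {X} {Y} X→Y Y→X with v ∈? X | v ∈? Y
  ... | yes _   | yes _   = refl
  ... | no  _   | no  _   = refl
  ... | yes v∈X | no  v∉Y = ⊥-elim (v∉Y (X→Y v∈X))
  ... | no  v∉X | yes v∈Y = ⊥-elim (v∉X (Y→X v∈Y))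

  ↾-mono : ∀ {X Y} → (∀ {w} → w ∈ X → 1 ≤ f w → w ∈ Y) → (f ↾ X) v ≤ (f ↾ Y) v
  ↾-mono {X} {Y} X⊆Y with v ∈? X | v ∈? Y | f v in fv
  ... | no  _   | _       | _     = z≤n
  ... | yes _   | yes _   | _     = ≤-refl
  ... | yes _   | no  _   | zero  = z≤n
  ... | yes v∈X | no  v∉Y | suc _ = ⊥-elim (v∉Y (X⊆Y v∈X (subst (1 ≤_) (sym fv) (s≤s z≤n))))

  ↾-supermodular : ∀ {X X′ Y Z} → (∀ {w} → w ∈ X → w ∈ Y ⊎ w ∈ Z) → (∀ {w} → w ∈ X′ → w ∈ Y × w ∈ Z) →
                   (f ↾ X) v + (f ↾ X′) v ≤ (f ↾ Y) v + (f ↾ Z) v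
  ↾-supermodular {X} {X′} {Y} {Z} ∪⁻ ∩⁻ with v ∈? X′
  ... | yes v∈X′ rewrite ↾-∈ {Y} (proj₁ (∩⁻ v∈X′)) | ↾-∈ {Z} (proj₂ (∩⁻ v∈X′)) = +-mono-≤ (↾-≤ X) ≤-refl
  ... | no  _ with v ∈? X
  ...   | no  _   = z≤n
  ...   | yes v∈X with ∪⁻ v∈X
  ...     | inj₁ v∈Y rewrite ↾-∈ {Y} v∈Y = +-monoʳ-≤ (f v) z≤n
  ...     | inj₂ v∈Z rewrite ↾-∈ {Z} v∈Z | ℕ.+-identityʳ (f v) = ℕ.m≤n+m (f v) _

↾-↾ : ∀ f {v X Y} → X ⊆ Y → (f ↾ X ↾ Y) v ≡ (f ↾ X) v
↾-↾ f {v} {X} {Y} X⊆Y with v ∈? Y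
... | yes _   = refl
... | no  v∉Y = sym (↾-∉ f (λ v∈X → v∉Y (X⊆Y v∈X)))

↾-∷ : ∀ f {v u K} → u ∉ K → (f ↾ (u ∷ K)) v ≡ (f ↾ [ u ]) v + (f ↾ K) v
↾-∷ f {v} {u} {K} u∉K with v ℕ.≟ u
... | yes refl rewrite ↾-∈ f {X = u ∷ K} (here refl) | ↾-∈ f {X = [ u ]} (here refl) | ↾-∉ f u∉K =
  sym (ℕ.+-identityʳ (f u))
... | no  v≢u rewrite ↾-∉ f {X = [ u ]} (λ { (here v≡u) → v≢u v≡u }) =
  ↾-cong f {Y = K} (λ { (here v≡u) → ⊥-elim (v≢u v≡u) ; (there v∈K) → v∈K }) there

↾-[]-sym : ∀ f {x u} → (f ↾ [ u ]) x ≡ (f ↾ [ x ]) u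
↾-[]-sym f {x} {u} with x ℕ.≟ u
... | yes refl = refl
... | no  x≢u rewrite ↾-∉ f {x} {[ u ]} (λ { (here x≡u) → x≢u x≡u })
                    | ↾-∉ f {u} {[ x ]} (λ { (here u≡x) → x≢u (sym u≡x) }) = refl

sumMap-↾-[] : ∀ {V} f u → Unique V → sumMap V (f ↾ [ u ]) ≡ (f ↾ V) u
sumMap-↾-[] f u []                = refl
sumMap-↾-[] f u (x∉V ∷ V-unique) =
  trans (cong₂ _+_ (↾-[]-sym f) (sumMap-↾-[] f u V-unique)) (sym (↾-∷ f (All¬⇒¬Any x∉V)))

sumMap-↾-swap : ∀ {V K} f → Unique V → Unique K → sumMap V (f ↾ K) ≡ sumMap K (f ↾ V)
sumMap-↾-swap {V} {[]}    f V-unique []                = sumMap-↾-empty V f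
sumMap-↾-swap {V} {u ∷ K} f V-unique (u∉K ∷ K-unique) = begin
  sumMap V (f ↾ (u ∷ K))                       ≡⟨ sumMap-cong V (All.universal (λ _ → ↾-∷ f (All¬⇒¬Any u∉K)) V) ⟩
  sumMap V (λ v → (f ↾ [ u ]) v + (f ↾ K) v)   ≡⟨ sumMap-+ V (f ↾ [ u ]) (f ↾ K) ⟩
  sumMap V (f ↾ [ u ]) + sumMap V (f ↾ K)      ≡⟨ cong₂ _+_ (sumMap-↾-[] f u V-unique) (sumMap-↾-swap f V-unique K-unique) ⟩
  (f ↾ V) u + sumMap K (f ↾ V)                 ∎
  where open ≡-Reasoning

sumMap-↾-⊆ : ∀ {D V} f → Unique D → Unique V → D ⊆ V → sumMap D f ≡ sumMap V (f ↾ D)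
sumMap-↾-⊆ {D} {V} f D-unique V-unique D⊆V = begin
  sumMap D f       ≡⟨ sumMap-cong D (All.tabulate (λ v∈D → sym (↾-∈ f (D⊆V v∈D)))) ⟩
  sumMap D (f ↾ V) ≡⟨ sumMap-↾-swap f V-unique D-unique ⟨
  sumMap V (f ↾ D) ∎
  where open ≡-Reasoning

≤∸1⇒< : ∀ {x n} → 1 ≤ n → x ≤ n ∸ 1 → x < n
≤∸1⇒< {n = suc n} _ x≤n = s≤s x≤n

decrementAt : ℕ → (ℕ → ℕ) → ℕ → ℕ
decrementAt v k w = k w ∸ ((λ _ → 1) ↾ [ v ]) w

decrementAt-≤ : ∀ v k w → decrementAt v k w ≤ k w
decrementAt-≤ v k w = ℕ.m∸n≤m (k w) (((λ _ → 1) ↾ [ v ]) w)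

decrementAt-< : ∀ v k {x} → 1 ≤ k v → x ≤ decrementAt v k v → x < k v
decrementAt-< v k 1≤kv x≤ rewrite ↾-∈ (λ _ → 1) {v} {[ v ]} (here refl) = ≤∸1⇒< 1≤kv x≤

infixr 6 _∪_
infixr 7 _∩_

_∪_ : List Bool → List Bool → List Bool
[]      ∪ n       = n
(b ∷ m) ∪ []      = b ∷ m
(b ∷ m) ∪ (c ∷ n) = (b ∨ c) ∷ (m ∪ n)

_∩_ : List Bool → List Bool → List Bool
[]      ∩ n       = []
(b ∷ m) ∩ []      = []
(b ∷ m) ∩ (c ∷ n) = (b ∧ c) ∷ (m ∩ n)

module _ {A : Set} where

  select : List Bool → List A → List A
  select []          F       = []
  select (_ ∷ _)     []      = []
  select (true ∷ m)  (a ∷ F) = a ∷ select m F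
  select (false ∷ m) (a ∷ F) = select m F

  select-[] : ∀ m → select m [] ≡ []
  select-[] []      = refl
  select-[] (_ ∷ _) = refl

  select-⊆ : ∀ m F → select m F Sublist.⊆ F
  select-⊆ []          F       = []⊆-universal F
  select-⊆ (_ ∷ _)     []      = []
  select-⊆ (true ∷ m)  (a ∷ F) = refl ∷ select-⊆ m F
  select-⊆ (false ∷ m) (a ∷ F) = a ∷ʳ select-⊆ m F

  ⊆⇒select : ∀ {G F} → G Sublist.⊆ F → ∃[ m ] G ≡ select m F
  ⊆⇒select []       = [] , refl
  ⊆⇒select (a ∷ʳ τ) with ⊆⇒select τ
  ... | m , G≡ = false ∷ m , G≡
  ⊆⇒select (refl ∷ τ) with ⊆⇒select τ
  ... | m , G≡ = true ∷ m , cong (_ ∷_) G≡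

  select-complete : ∀ m F → length (select m F) ≡ length F → select m F ≡ F
  select-complete m F same-length = Pointwise-≡⇒≡ (to-≋ same-length (select-⊆ m F))

  select-∩ˡ : ∀ m n F → select (m ∩ n) F Sublist.⊆ select m F
  select-∩ˡ []          n           F       = []⊆-universal _
  select-∩ˡ (_ ∷ _)     []          F       = []⊆-universal _
  select-∩ˡ (_ ∷ _)     (_ ∷ _)     []      = []
  select-∩ˡ (true ∷ m)  (true ∷ n)  (a ∷ F) = refl ∷ select-∩ˡ m n F
  select-∩ˡ (true ∷ m)  (false ∷ n) (a ∷ F) = a ∷ʳ select-∩ˡ m n F
  select-∩ˡ (false ∷ m) (_ ∷ n)     (a ∷ F) = select-∩ˡ m n F

  select-∩ʳ : ∀ m n F → select (m ∩ n) F Sublist.⊆ select n F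
  select-∩ʳ []          n           F       = []⊆-universal _
  select-∩ʳ (_ ∷ _)     []          F       = []⊆-universal _
  select-∩ʳ (_ ∷ _)     (_ ∷ _)     []      = []
  select-∩ʳ (true ∷ m)  (true ∷ n)  (a ∷ F) = refl ∷ select-∩ʳ m n F
  select-∩ʳ (false ∷ m) (true ∷ n)  (a ∷ F) = a ∷ʳ select-∩ʳ m n F
  select-∩ʳ (true ∷ m)  (false ∷ n) (a ∷ F) = select-∩ʳ m n F
  select-∩ʳ (false ∷ m) (false ∷ n) (a ∷ F) = select-∩ʳ m n F

  select-∪ˡ : ∀ m n F → select m F Sublist.⊆ select (m ∪ n) F
  select-∪ˡ []          n           F       = []⊆-universal _
  select-∪ˡ (_ ∷ _)     []          F       = Sublist.⊆-refl
  select-∪ˡ (_ ∷ _)     (_ ∷ _)     []      = []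
  select-∪ˡ (true ∷ m)  (c ∷ n)     (a ∷ F) = refl ∷ select-∪ˡ m n F
  select-∪ˡ (false ∷ m) (true ∷ n)  (a ∷ F) = a ∷ʳ select-∪ˡ m n F
  select-∪ˡ (false ∷ m) (false ∷ n) (a ∷ F) = select-∪ˡ m n F

  select-∪ʳ : ∀ m n F → select n F Sublist.⊆ select (m ∪ n) F
  select-∪ʳ []          n           F       = Sublist.⊆-refl
  select-∪ʳ (_ ∷ _)     []          F       = []⊆-universal _
  select-∪ʳ (_ ∷ _)     (_ ∷ _)     []      = []
  select-∪ʳ (true ∷ m)  (true ∷ n)  (a ∷ F) = refl ∷ select-∪ʳ m n F
  select-∪ʳ (true ∷ m)  (false ∷ n) (a ∷ F) = a ∷ʳ select-∪ʳ m n F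
  select-∪ʳ (false ∷ m) (true ∷ n)  (a ∷ F) = refl ∷ select-∪ʳ m n F
  select-∪ʳ (false ∷ m) (false ∷ n) (a ∷ F) = select-∪ʳ m n F

  ∈-select-∷ : ∀ b n {a x F} → x ∈ select n F → x ∈ select (b ∷ n) (a ∷ F)
  ∈-select-∷ true  n x∈ = there x∈
  ∈-select-∷ false n x∈ = x∈

  ∈-select-∪⁻ : ∀ m n F {a} → a ∈ select (m ∪ n) F → a ∈ select m F ⊎ a ∈ select n F
  ∈-select-∪⁻ []          n           F       a∈         = inj₂ a∈
  ∈-select-∪⁻ (_ ∷ _)     []          F       a∈         = inj₁ a∈
  ∈-select-∪⁻ (_ ∷ _)     (_ ∷ _)     []      ()
  ∈-select-∪⁻ (true ∷ m)  (c ∷ n)     (a ∷ F) (here refl) = inj₁ (here refl)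
  ∈-select-∪⁻ (true ∷ m)  (c ∷ n)     (a ∷ F) (there a∈) =
    Sum.map there (∈-select-∷ c n) (∈-select-∪⁻ m n F a∈)
  ∈-select-∪⁻ (false ∷ m) (true ∷ n)  (a ∷ F) (here refl) = inj₂ (here refl)
  ∈-select-∪⁻ (false ∷ m) (true ∷ n)  (a ∷ F) (there a∈) = Sum.map₂ there (∈-select-∪⁻ m n F a∈)
  ∈-select-∪⁻ (false ∷ m) (false ∷ n) (a ∷ F) a∈         = ∈-select-∪⁻ m n F a∈

  length-select-∪-∩ : ∀ m n F → length (select (m ∪ n) F) + length (select (m ∩ n) F) ≡ length (select m F) + length (select n F)
  length-select-∪-∩ m n [] rewrite select-[] (m ∪ n) | select-[] (m ∩ n) | select-[] m | select-[] n = refl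
  length-select-∪-∩ []          n           (a ∷ F) = +-comm (length (select n (a ∷ F))) 0
  length-select-∪-∩ (_ ∷ _)     []          (a ∷ F) = refl
  length-select-∪-∩ (true ∷ m)  (true ∷ n)  (a ∷ F) =
    cong suc (trans (+-suc _ _) (trans (cong suc (length-select-∪-∩ m n F)) (sym (+-suc _ _))))
  length-select-∪-∩ (true ∷ m)  (false ∷ n) (a ∷ F) = cong suc (length-select-∪-∩ m n F)
  length-select-∪-∩ (false ∷ m) (true ∷ n)  (a ∷ F) = trans (cong suc (length-select-∪-∩ m n F)) (sym (+-suc _ _))
  length-select-∪-∩ (false ∷ m) (false ∷ n) (a ∷ F) = length-select-∪-∩ m n F


module CapacitatedHall {A : Set} (nb : A → List ℕ) where

  Γ : List A → List ℕ
  Γ = concatMap nb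

  ∈-Γ⁺ : ∀ {a v H} → a ∈ H → v ∈ nb a → v ∈ Γ H
  ∈-Γ⁺ a∈H v∈a = ∈-concatMap⁺ nb (lose a∈H v∈a)

  Γ-mono : ∀ {H H′} → (∀ {a} → a ∈ H → a ∈ H′) → Γ H ⊆ Γ H′
  Γ-mono {H} H⊆H′ v∈ΓH with find (∈-concatMap⁻ nb {H} v∈ΓH)
  ... | a , a∈H , v∈a = ∈-Γ⁺ (H⊆H′ a∈H) v∈a

  Group : Set
  Group = ℕ × List A

  Admissible : (ℕ → ℕ) → Group → Set
  Admissible k (v , g) = All (λ a → v ∈ nb a) g × length g ≤ k v

  -- The decomposition F = F₁ + ⋯ + F_m of matching satisfiability, as the list of groups (v_i , F_i).
  Matching : (ℕ → ℕ) → List A → Set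
  Matching k G = Σ[ ps ∈ List Group ] (concat (map proj₂ ps) ↭ G × Unique (map proj₁ ps) × All (Admissible k) ps)

  Matching-↭ : ∀ {k G G′} → G ↭ G′ → Matching k G → Matching k G′
  Matching-↭ G↭G′ (ps , ps↭G , unique , admissible) = ps , ↭-trans ps↭G G↭G′ , unique , admissible

  insert : ℕ → A → List Group → List Group
  insert v a []              = (v , [ a ]) ∷ []
  insert v a ((w , g) ∷ ps) with v ℕ.≟ w
  ... | yes _ = (w , a ∷ g) ∷ ps
  ... | no  _ = (w , g) ∷ insert v a ps

  insert-↭ : ∀ v a ps → concat (map proj₂ (insert v a ps)) ↭ a ∷ concat (map proj₂ ps)
  insert-↭ v a []              = ↭-refl
  insert-↭ v a ((w , g) ∷ ps) with v ℕ.≟ w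
  ... | yes _ = ↭-refl
  ... | no  _ = ↭-trans (++⁺ˡ g (insert-↭ v a ps)) (shift a g (concat (map proj₂ ps)))

  ∈-insert⁻ : ∀ v a ps {x} → x ∈ map proj₁ (insert v a ps) → x ≡ v ⊎ x ∈ map proj₁ ps
  ∈-insert⁻ v a []              (here x≡v) = inj₁ x≡v
  ∈-insert⁻ v a ((w , g) ∷ ps) x∈ with v ℕ.≟ w | x∈
  ... | yes _ | x∈′       = inj₂ x∈′
  ... | no  _ | here x≡w  = inj₂ (here x≡w)
  ... | no  _ | there x∈′ with ∈-insert⁻ v a ps x∈′
  ...   | inj₁ x≡v  = inj₁ x≡v
  ...   | inj₂ x∈ps = inj₂ (there x∈ps)

  insert-unique : ∀ v a ps → Unique (map proj₁ ps) → Unique (map proj₁ (insert v a ps))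
  insert-unique v a []              _               = [] ∷ []
  insert-unique v a ((w , g) ∷ ps) (w∉ps ∷ unique) with v ℕ.≟ w
  ... | yes _   = w∉ps ∷ unique
  ... | no  v≢w = All.tabulate w∉insert ∷ insert-unique v a ps unique
    where
    w∉insert : ∀ {x} → x ∈ map proj₁ (insert v a ps) → ¬ w ≡ x
    w∉insert x∈ w≡x with ∈-insert⁻ v a ps x∈
    ... | inj₁ x≡v  = v≢w (trans (sym x≡v) (sym w≡x))
    ... | inj₂ x∈ps = All.lookup w∉ps x∈ps w≡x

  insert-admissible : ∀ {v a k} ps → v ∈ nb a → 1 ≤ k v →
                      All (Admissible (decrementAt v k)) ps → All (Admissible k) (insert v a ps)
  insert-admissible []              v∈a 1≤kv [] = ((v∈a ∷ []) , 1≤kv) ∷ []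
  insert-admissible {v} {a} {k} ((w , g) ∷ ps) v∈a 1≤kv ((w∈g , g≤) ∷ admissible) with v ℕ.≟ w
  ... | yes refl = ((v∈a ∷ w∈g) , decrementAt-< v k 1≤kv g≤) ∷ All.map relax admissible
    where
    relax : ∀ {p} → Admissible (decrementAt v k) p → Admissible k p
    relax {u , _} (u∈ , ≤k) = u∈ , ≤-trans ≤k (decrementAt-≤ v k u)
  ... | no  _    = (w∈g , ≤-trans g≤ (decrementAt-≤ v k w)) ∷ insert-admissible ps v∈a 1≤kv admissible

  Matching-∷ : ∀ {v a k G} → v ∈ nb a → 1 ≤ k v → Matching (decrementAt v k) G → Matching k (a ∷ G)
  Matching-∷ {v} {a} v∈a 1≤kv (ps , ps↭G , unique , admissible) =
    insert v a ps , ↭-trans (insert-↭ v a ps) (prep a ps↭G) , insert-unique v a ps unique ,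
    insert-admissible ps v∈a 1≤kv admissible

  module Weighted {V : List ℕ} (V-unique : Unique V) where

    weight : (ℕ → ℕ) → List A → ℕ
    weight k H = sumMap V (k ↾ Γ H)

    weight-decrementAt : ∀ v k H → weight k H ≤ weight (decrementAt v k) H + 1
    weight-decrementAt v k H = begin
      sumMap V (k ↾ Γ H)                                        ≤⟨ sumMap-mono V pointwise ⟩
      sumMap V (λ w → (decrementAt v k ↾ Γ H) w + (one ↾ [ v ]) w) ≡⟨ sumMap-+ V _ _ ⟩
      weight (decrementAt v k) H + sumMap V (one ↾ [ v ])       ≡⟨ cong (weight (decrementAt v k) H ℕ.+_) (sumMap-↾-[] one v V-unique) ⟩
      weight (decrementAt v k) H + (one ↾ V) v                  ≤⟨ +-monoʳ-≤ _ (↾-≤ one V) ⟩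
      weight (decrementAt v k) H + 1                            ∎
      where
      open ≤-Reasoning
      one : ℕ → ℕ
      one _ = 1
      pointwise : ∀ w → (k ↾ Γ H) w ≤ (decrementAt v k ↾ Γ H) w + (one ↾ [ v ]) w
      pointwise w with w ∈? Γ H
      ... | yes _ = subst (k w ≤_) (+-comm e (k w ∸ e)) (ℕ.m≤n+m∸n (k w) e)
        where e = (one ↾ [ v ]) w
      ... | no  _ = z≤n

    weight-decrementAt-∉ : ∀ {v} k H → v ∉ Γ H → weight k H ≤ weight (decrementAt v k) H
    weight-decrementAt-∉ {v} k H v∉ΓH = sumMap-mono V pointwise
      where
      pointwise : ∀ w → (k ↾ Γ H) w ≤ (decrementAt v k ↾ Γ H) w
      pointwise w with w ∈? Γ H
      ... | no  _    = z≤n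
      ... | yes w∈ΓH rewrite ↾-∉ (λ _ → 1) {w} {[ v ]} (λ { (here refl) → v∉ΓH w∈ΓH }) = ≤-refl

    weight-supermodular : ∀ k m n F →
      weight k (select (m ∪ n) F) + weight k (select (m ∩ n) F) ≤ weight k (select m F) + weight k (select n F)
    weight-supermodular k m n F = begin
      weight k (select (m ∪ n) F) + weight k (select (m ∩ n) F)
        ≡⟨ sumMap-+ V (k ↾ Γ (select (m ∪ n) F)) (k ↾ Γ (select (m ∩ n) F)) ⟨
      sumMap V (λ v → (k ↾ Γ (select (m ∪ n) F)) v + (k ↾ Γ (select (m ∩ n) F)) v)
        ≤⟨ sumMap-mono V (λ v → ↾-supermodular k Γ-∪⁻ (λ v∈ → Γ-∩ˡ v∈ , Γ-∩ʳ v∈)) ⟩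
      sumMap V (λ v → (k ↾ Γ (select m F)) v + (k ↾ Γ (select n F)) v)
        ≡⟨ sumMap-+ V (k ↾ Γ (select m F)) (k ↾ Γ (select n F)) ⟩
      weight k (select m F) + weight k (select n F) ∎
      where
      open ≤-Reasoning
      Γ-∪⁻ : ∀ {v} → v ∈ Γ (select (m ∪ n) F) → v ∈ Γ (select m F) ⊎ v ∈ Γ (select n F)
      Γ-∪⁻ v∈ with find (∈-concatMap⁻ nb {select (m ∪ n) F} v∈)
      ... | a , a∈ , v∈a = Sum.map (λ a∈m → ∈-Γ⁺ a∈m v∈a) (λ a∈n → ∈-Γ⁺ a∈n v∈a) (∈-select-∪⁻ m n F a∈)
      Γ-∩ˡ : Γ (select (m ∩ n) F) ⊆ Γ (select m F)
      Γ-∩ˡ = Γ-mono (Sublist.lookup (select-∩ˡ m n F))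
      Γ-∩ʳ : Γ (select (m ∩ n) F) ⊆ Γ (select n F)
      Γ-∩ʳ = Γ-mono (Sublist.lookup (select-∩ʳ m n F))

    -- A matched clause with all its neighbours in X sits in a group at a vertex of X.
    length-filter-⊆-≤ : ∀ {k G X} → X ⊆ V → Matching k G → length (filter (λ a → nb a ⊆? X) G) ≤ sumMap V (k ↾ X)
    length-filter-⊆-≤ {k} {G} {X} X⊆V (ps , ps↭G , unique , admissible) = begin
      length (filter P? G)                         ≡⟨ ↭-length (filter-↭ P? (↭-sym ps↭G)) ⟩
      length (filter P? (concat (map proj₂ ps)))   ≤⟨ groups ps admissible ⟩
      sumMap (map proj₁ ps) (k ↾ X)                ≡⟨ sumMap-cong (map proj₁ ps) (All.universal (λ _ → sym (↾-↾ k X⊆V)) _) ⟩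
      sumMap (map proj₁ ps) (k ↾ X ↾ V)            ≡⟨ sumMap-↾-swap (k ↾ X) V-unique unique ⟨
      sumMap V (k ↾ X ↾ map proj₁ ps)              ≤⟨ sumMap-mono V (λ v → ↾-≤ (k ↾ X) (map proj₁ ps)) ⟩
      sumMap V (k ↾ X)                             ∎
      where
      open ≤-Reasoning
      P? = λ a → nb a ⊆? X
      group : ∀ v g → All (λ a → v ∈ nb a) g → length g ≤ k v → length (filter P? g) ≤ (k ↾ X) v
      group v g v∈g g≤ with v ∈? X
      ... | yes _   = ≤-trans (length-filter P? g) g≤
      ... | no  v∉X = ℕ.≤-reflexive (cong length (filter-none P? (All.map (λ v∈a nb⊆X → v∉X (nb⊆X v∈a)) v∈g)))
      groups : ∀ ps → All (Admissible k) ps → length (filter P? (concat (map proj₂ ps))) ≤ sumMap (map proj₁ ps) (k ↾ X)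
      groups []              []                       = z≤n
      groups ((v , g) ∷ ps) ((v∈g , g≤) ∷ admissible)
        rewrite filter-++ P? g (concat (map proj₂ ps)) | length-++ (filter P? g) {filter P? (concat (map proj₂ ps))} =
        +-mono-≤ (group v g v∈g g≤) (groups ps admissible)

    matching-bound : ∀ {k} g h F → Γ F ⊆ V → Matching k (select g F) →
                     length (select g F) + length (select h F) ≤ length F + weight k (select h F)
    matching-bound {k} g h F ΓF⊆V matching = begin
      length (select g F) + length (select h F)             ≡⟨ length-select-∪-∩ g h F ⟨
      length (select (g ∪ h) F) + length (select (g ∩ h) F) ≤⟨ +-mono-≤ (length-mono-≤ (select-⊆ (g ∪ h) F)) confined ⟩
      length F + length (filter P? (select g F))            ≤⟨ +-monoʳ-≤ (length F) (length-filter-⊆-≤ X⊆V matching) ⟩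
      length F + weight k (select h F)                      ∎
      where
      open ≤-Reasoning
      X = Γ (select h F)
      P? = λ a → nb a ⊆? X
      X⊆V : X ⊆ V
      X⊆V = ΓF⊆V ∘ Γ-mono (Sublist.lookup (select-⊆ h F))
      confined : length (select (g ∩ h) F) ≤ length (filter P? (select g F))
      confined = begin
        length (select (g ∩ h) F)            ≡⟨ cong length (filter-all P? (All.tabulate (λ a∈ v∈a → ∈-Γ⁺ (Sublist.lookup (select-∩ʳ g h F) a∈) v∈a))) ⟨
        length (filter P? (select (g ∩ h) F)) ≤⟨ length-mono-≤ (filter⁺ P? P? (λ { refl nb⊆X → nb⊆X }) (select-∩ˡ g h F)) ⟩
        length (filter P? (select g F))      ∎

    -- |F| − |select g F| ≤ |select h F| − weight k (select h F) without subtraction: the deficiency of h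
    -- accounts for every clause that g leaves unmatched.
    Tight : (ℕ → ℕ) → List A → List Bool → List Bool → Set
    Tight k F g h = length F + weight k (select h F) ≤ length (select g F) + length (select h F)

    MaximumMatching : (ℕ → ℕ) → List A → Set
    MaximumMatching k F = Σ[ g ∈ List Bool ] (Matching k (select g F) × Σ[ h ∈ List Bool ] Tight k F g h)

    Tight-∪ : ∀ {k g F} a b → Γ F ⊆ V → Matching k (select g F) → Tight k F g a → Tight k F g b → Tight k F g (a ∪ b)
    Tight-∪ {k} {g} {F} a b ΓF⊆V matching tight-a tight-b =
      combine (length F) (length (select g F))
              (length (select a F)) (length (select b F)) (length (select (a ∪ b) F)) (length (select (a ∩ b) F))
              (weight k (select a F)) (weight k (select b F)) (weight k (select (a ∪ b) F)) (weight k (select (a ∩ b) F))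
              tight-a tight-b (matching-bound g (a ∩ b) F ΓF⊆V matching) (length-select-∪-∩ a b F) (weight-supermodular k a b F)
      where
      -- Subtraction-free form of: deficiency is supermodular, and that of a ∩ b is at most |F| − |g|.
      combine : ∀ f G a b u i Wa Wb Wu Wi → f + Wa ≤ G + a → f + Wb ≤ G + b → G + i ≤ f + Wi →
                u + i ≡ a + b → Wu + Wi ≤ Wa + Wb → f + Wu ≤ G + u
      combine f G a b u i Wa Wb Wu Wi tight-a tight-b bound-i card super =
        ℕ.+-cancelʳ-≤ (G + i) (f + Wu) (G + u) (begin
          (f + Wu) + (G + i)  ≤⟨ +-monoʳ-≤ (f + Wu) bound-i ⟩
          (f + Wu) + (f + Wi) ≡⟨ interchange f Wu f Wi ⟩
          (f + f) + (Wu + Wi) ≤⟨ +-monoʳ-≤ (f + f) super ⟩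
          (f + f) + (Wa + Wb) ≡⟨ interchange f f Wa Wb ⟩
          (f + Wa) + (f + Wb) ≤⟨ +-mono-≤ tight-a tight-b ⟩
          (G + a) + (G + b)   ≡⟨ interchange G a G b ⟩
          (G + G) + (a + b)   ≡⟨ cong ((G + G) ℕ.+_) card ⟨
          (G + G) + (u + i)   ≡⟨ interchange G G u i ⟩
          (G + u) + (G + i)   ∎)
        where
        open ≤-Reasoning

    module Extend (C : A) (F : List A) (ΓF⊆V : Γ F ⊆ V) (k : ℕ → ℕ) (ih : ∀ k′ → MaximumMatching k′ F) where

      g₀ : List Bool
      g₀ = proj₁ (ih k)

      matching₀ : Matching k (select g₀ F)
      matching₀ = proj₁ (proj₂ (ih k))

      h₀ : List Bool
      h₀ = proj₁ (proj₂ (proj₂ (ih k)))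

      tight₀ : Tight k F g₀ h₀
      tight₀ = proj₂ (proj₂ (proj₂ (ih k)))

      Covering : List ℕ → Set
      Covering L = Σ[ U ∈ List Bool ] (Tight k F g₀ U × (∀ {w} → w ∈ L → 1 ≤ k w → w ∈ Γ (select U F)))

      extend-via-fresh : ∀ {v gᵥ hᵥ} → v ∈ nb C → 1 ≤ k v →
                         Matching (decrementAt v k) (select gᵥ F) → Tight (decrementAt v k) F gᵥ hᵥ →
                         v ∉ Γ (select hᵥ F) → MaximumMatching k (C ∷ F)
      extend-via-fresh {v} {gᵥ} {hᵥ} v∈C 1≤kv matchingᵥ tightᵥ v∉Γhᵥ =
        true ∷ gᵥ , Matching-∷ v∈C 1≤kv matchingᵥ , false ∷ hᵥ ,
        s≤s (≤-trans (+-monoʳ-≤ (length F) (weight-decrementAt-∉ k (select hᵥ F) v∉Γhᵥ)) tightᵥ)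

      extend-via-larger : ∀ {v gᵥ} → v ∈ nb C → 1 ≤ k v → Matching (decrementAt v k) (select gᵥ F) →
                          length (select g₀ F) ≤ length (select gᵥ F) → MaximumMatching k (C ∷ F)
      extend-via-larger {v} {gᵥ} v∈C 1≤kv matchingᵥ g₀≤gᵥ =
        true ∷ gᵥ , Matching-∷ v∈C 1≤kv matchingᵥ , false ∷ h₀ ,
        s≤s (≤-trans tight₀ (+-monoˡ-≤ (length (select h₀ F)) g₀≤gᵥ))

      tight-decrementAt : ∀ {v gᵥ hᵥ} → Tight (decrementAt v k) F gᵥ hᵥ →
                          length (select gᵥ F) < length (select g₀ F) → Tight k F g₀ hᵥ
      tight-decrementAt {v} {gᵥ} {hᵥ} tightᵥ gᵥ<g₀ = begin
        length F + weight k (select hᵥ F)                              ≤⟨ +-monoʳ-≤ (length F) (weight-decrementAt v k (select hᵥ F)) ⟩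
        length F + (weight (decrementAt v k) (select hᵥ F) + 1)        ≡⟨ +-assoc (length F) _ 1 ⟨
        length F + weight (decrementAt v k) (select hᵥ F) + 1          ≤⟨ +-monoˡ-≤ 1 tightᵥ ⟩
        length (select gᵥ F) + length (select hᵥ F) + 1                ≡⟨ +-comm _ 1 ⟩
        suc (length (select gᵥ F) + length (select hᵥ F))              ≤⟨ +-monoˡ-≤ (length (select hᵥ F)) gᵥ<g₀ ⟩
        length (select g₀ F) + length (select hᵥ F)                    ∎
        where open ≤-Reasoning

      cover : ∀ L → L ⊆ nb C → MaximumMatching k (C ∷ F) ⊎ Covering L
      cover []      _      = inj₂ (h₀ , tight₀ , λ ())
      cover (v ∷ L) L⊆nbC with cover L (L⊆nbC ∘ there)
      ... | inj₁ extended                = inj₁ extended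
      ... | inj₂ (U , tight-U , covers-L) with 1 ≤? k v
      ...   | no  1≰kv = inj₂ (U , tight-U , λ { (here refl) 1≤kv → ⊥-elim (1≰kv 1≤kv) ; (there w∈L) → covers-L w∈L })
      ...   | yes 1≤kv with ih (decrementAt v k)
      ...     | gᵥ , matchingᵥ , hᵥ , tightᵥ with v ∈? Γ (select hᵥ F)
      ...       | no  v∉Γhᵥ = inj₁ (extend-via-fresh {v} {gᵥ} {hᵥ} (L⊆nbC (here refl)) 1≤kv matchingᵥ tightᵥ v∉Γhᵥ)
      ...       | yes v∈Γhᵥ with length (select g₀ F) ≤? length (select gᵥ F)
      ...         | yes g₀≤gᵥ = inj₁ (extend-via-larger {v} {gᵥ} (L⊆nbC (here refl)) 1≤kv matchingᵥ g₀≤gᵥ)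
      ...         | no  g₀≰gᵥ =
        inj₂ (U ∪ hᵥ , Tight-∪ {g = g₀} U hᵥ ΓF⊆V matching₀ tight-U (tight-decrementAt {v} {gᵥ} {hᵥ} tightᵥ (ℕ.≰⇒> g₀≰gᵥ)) , covers)
        where
        covers : ∀ {w} → w ∈ v ∷ L → 1 ≤ k w → w ∈ Γ (select (U ∪ hᵥ) F)
        covers (here refl)  _    = Γ-mono (Sublist.lookup (select-∪ʳ U hᵥ F)) v∈Γhᵥ
        covers (there w∈L) 1≤kw = Γ-mono (Sublist.lookup (select-∪ˡ U hᵥ F)) (covers-L w∈L 1≤kw)

      -- Once every neighbour of C with spare capacity lies in Γ U, adding C to U costs no weight.
      extend-covered : Covering (nb C) → MaximumMatching k (C ∷ F)
      extend-covered (U , tight-U , covers) =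
        false ∷ g₀ , matching₀ , true ∷ U ,
        subst (suc (length F) + weight k (C ∷ select U F) ≤_) (sym (+-suc (length (select g₀ F)) (length (select U F))))
              (s≤s (≤-trans (+-monoʳ-≤ (length F) weight-C∷U) tight-U))
        where
        weight-C∷U : weight k (C ∷ select U F) ≤ weight k (select U F)
        weight-C∷U = sumMap-mono V (λ _ → ↾-mono k (λ w∈ 1≤kw → Sum.[ (λ w∈C → covers w∈C 1≤kw) , id ] (∈-++⁻ (nb C) w∈)))

      extended : MaximumMatching k (C ∷ F)
      extended = Sum.[ id , extend-covered ] (cover (nb C) id)

    maximumMatching : ∀ F → Γ F ⊆ V → ∀ k → MaximumMatching k F
    maximumMatching []      _     k = [] , ([] , ↭-refl , [] , []) , [] , ℕ.≤-reflexive (sumMap-↾-empty V k)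
    maximumMatching (C ∷ F) ΓC∷F⊆V k =
      Extend.extended C F ΓF⊆V k (λ k′ → maximumMatching F ΓF⊆V k′)
      where
      ΓF⊆V : Γ F ⊆ V
      ΓF⊆V = ΓC∷F⊆V ∘ ∈-++⁺ʳ (nb C)

private
  add-sub : ∀ a b → a ≡ (a ℤ.+ b) - b
  add-sub = solve-∀

  sub-difference : ∀ a b c → (a ℤ.+ c) - b ≡ a - (b - c)
  sub-difference = solve-∀

≤-minus-difference : ∀ {x f} p q → x + p ≤ f + q → + x ℤ.≤ + f - (+ p - + q)
≤-minus-difference {x} {f} p q x+p≤f+q = begin
  + x                  ≡⟨ add-sub (+ x) (+ p) ⟩
  + (x + p) - + p      ≤⟨ ℤ.+-monoˡ-≤ (ℤ.- + p) (+≤+ x+p≤f+q) ⟩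
  + (f + q) - + p      ≡⟨ sub-difference (+ f) (+ p) (+ q) ⟩
  + f - (+ p - + q)    ∎
  where open ℤ.≤-Reasoning

minus-difference-≤ : ∀ {x f} p q → f + q ≤ x + p → + f - (+ p - + q) ℤ.≤ + x
minus-difference-≤ {x} {f} p q f+q≤x+p = begin
  + f - (+ p - + q)    ≡⟨ sub-difference (+ f) (+ p) (+ q) ⟨
  + (f + q) - + p      ≤⟨ ℤ.+-monoˡ-≤ (ℤ.- + p) (+≤+ f+q≤x+p) ⟩
  + (x + p) - + p      ≡⟨ add-sub (+ x) (+ p) ⟨
  + x                  ∎
  where open ℤ.≤-Reasoning

module _ (d : ℕ → ℕ) where

  maxℤ-≥-init : ∀ xs a → a ℤ.≤ maxℤ d xs a
  maxℤ-≥-init []       a = ℤ.≤-refl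
  maxℤ-≥-init (x ∷ xs) a = ℤ.≤-trans (ℤ.i≤j⊔i x a) (maxℤ-≥-init xs (x ⊔ a))

  maxℤ-≥ : ∀ xs a {y} → y ∈ xs → y ℤ.≤ maxℤ d xs a
  maxℤ-≥ (x ∷ xs) a (here refl) = ℤ.≤-trans (ℤ.i≤i⊔j x a) (maxℤ-≥-init xs (x ⊔ a))
  maxℤ-≥ (x ∷ xs) a (there y∈) = maxℤ-≥ xs (x ⊔ a) y∈

  maxℤ-∈ : ∀ xs a → maxℤ d xs a ≡ a ⊎ maxℤ d xs a ∈ xs
  maxℤ-∈ []       a = inj₁ refl
  maxℤ-∈ (x ∷ xs) a with maxℤ-∈ xs (x ⊔ a)
  ... | inj₂ max∈xs = inj₂ (there max∈xs)
  ... | inj₁ max≡ with ℤ.⊔-sel x a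
  ...   | inj₁ x⊔a≡x = inj₂ (here (trans max≡ x⊔a≡x))
  ...   | inj₂ x⊔a≡a = inj₁ (trans max≡ x⊔a≡a)

  select∈subs : ∀ {A : Set} m (F : List A) → select m F ∈ subs d F
  select∈subs []          []      = here refl
  select∈subs (_ ∷ _)     []      = here refl
  select∈subs []          (a ∷ F) = ∈-++⁺ˡ (select∈subs [] F)
  select∈subs (true ∷ m)  (a ∷ F) = ∈-++⁺ʳ (subs d F) (∈-map⁺ (a ∷_) (select∈subs m F))
  select∈subs (false ∷ m) (a ∷ F) = ∈-++⁺ˡ (select∈subs m F)

  ∈subs⇒select : ∀ {A : Set} (F : List A) {G} → G ∈ subs d F → ∃[ m ] G ≡ select m F
  ∈subs⇒select []      (here refl) = [] , refl
  ∈subs⇒select (a ∷ F) G∈ with ∈-++⁻ (subs d F) G∈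
  ... | inj₁ G∈F with ∈subs⇒select F G∈F
  ...   | m , G≡ = false ∷ m , G≡
  ∈subs⇒select (a ∷ F) G∈ | inj₂ G∈a∷F with ∈-map⁻ (a ∷_) G∈a∷F
  ...   | G′ , G′∈ , refl with ∈subs⇒select F G′∈
  ...     | m , G′≡ = true ∷ m , cong (a ∷_) G′≡

  δ*-attained : ∀ F → ∃[ h ] δ* d F ≡ δ d (select h F)
  δ*-attained F with maxℤ-∈ (map (δ d) (subs d F)) (δ d [])
  ... | inj₁ δ*≡ = [] , δ*≡
  ... | inj₂ δ*∈ with ∈-map⁻ (δ d) δ*∈
  ...   | G , G∈ , δ*≡ with ∈subs⇒select F G∈
  ...     | h , refl = h , δ*≡

  δ-select-≤-δ* : ∀ F h → δ d (select h F) ℤ.≤ δ* d F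
  δ-select-≤-δ* F h = maxℤ-≥ (map (δ d) (subs d F)) (δ d []) (∈-map⁺ (δ d) (select∈subs h F))

  δ*-nonneg : ∀ F → + 0 ℤ.≤ δ* d F
  δ*-nonneg F = maxℤ-≥-init (map (δ d) (subs d F)) (δ d [])

module MatchingDeficiency (d : ℕ → ℕ) (d-pos : ∀ v → 0 < d v) (F : MCS d) where

  open CapacitatedHall (varC d)
  open Weighted (deduplicate-! (concatMap (varC d) F))

  capacity : ℕ → ℕ
  capacity v = d v ∸ 1

  MatchingSat⇔Matching : ∀ G → MatchingSat d G ⇔ Matching capacity G
  MatchingSat⇔Matching G = mk⇔
    (λ (ps , ps↭G , unique , ok) → ps , ps↭G , unique , All.map (λ (v∈ , c<d) → v∈ , ℕ.<⇒≤pred c<d) ok)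
    (λ (ps , ps↭G , unique , ok) → ps , ps↭G , unique , All.map (λ {(v , _)} (v∈ , c≤) → v∈ , ≤∸1⇒< (d-pos v) c≤) ok)

  ΓF⊆varF : Γ F ⊆ varF d F
  ΓF⊆varF = ∈-deduplicate⁺ ℕ._≟_

  rd-select : ∀ h → rd d (select h F) ≡ weight capacity (select h F)
  rd-select h = begin
    sumMap D capacity              ≡⟨ sumMap-↾-⊆ capacity (deduplicate-! (Γ H)) (deduplicate-! (concatMap (varC d) F)) D⊆varF ⟩
    sumMap (varF d F) (capacity ↾ D) ≡⟨ sumMap-cong (varF d F) (All.universal (λ _ → ↾-cong capacity (∈-deduplicate⁻ ℕ._≟_ (Γ H)) (∈-deduplicate⁺ ℕ._≟_)) _) ⟩
    weight capacity H              ∎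
    where
    open ≡-Reasoning
    H = select h F
    D = deduplicate ℕ._≟_ (Γ H)
    D⊆varF : D ⊆ varF d F
    D⊆varF = ΓF⊆varF ∘ Γ-mono (Sublist.lookup (select-⊆ h F)) ∘ ∈-deduplicate⁻ ℕ._≟_ (Γ H)

  δ-select : ∀ h → δ d (select h F) ≡ + length (select h F) - + weight capacity (select h F)
  δ-select h = cong (λ r → + length (select h F) - + r) (rd-select h)

  matchingSat-bound : ∀ {F′} → _≤ₘ_ d F′ F → MatchingSat d F′ → ∀ h →
                      c d F′ + length (select h F) ≤ c d F + weight capacity (select h F)
  matchingSat-bound {F′} (G , G⊆F , F′↭G) sat h with ⊆⇒select G⊆F
  ... | g , refl = subst (λ n → n + length (select h F) ≤ length F + weight capacity (select h F)) (sym (↭-length F′↭G))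
    (matching-bound g h F ΓF⊆varF (Matching-↭ F′↭G (Equivalence.to (MatchingSat⇔Matching F′) sat)))

  matchingSat-≤ : ∀ F′ → _≤ₘ_ d F′ F → MatchingSat d F′ → + c d F′ ℤ.≤ + c d F - δ* d F
  matchingSat-≤ F′ F′≤F sat with δ*-attained d F
  ... | h , δ*≡ rewrite δ*≡ | δ-select h = ≤-minus-difference _ (weight capacity (select h F)) (matchingSat-bound F′≤F sat h)

  maximumMatchingSat-select : ∃[ g ] (MatchingSat d (select g F) × + length (select g F) ≡ + c d F - δ* d F)
  maximumMatchingSat-select with maximumMatching F ΓF⊆varF capacity
  ... | g , matching , h , tight = g , sat , ℤ.≤-antisym
    (matchingSat-≤ (select g F) (select g F , select-⊆ g F , ↭-refl) sat)
    (ℤ.≤-trans (ℤ.+-monoʳ-≤ (+ length F) (ℤ.neg-mono-≤ δ-h≤δ*))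
               (minus-difference-≤ (length (select h F)) (weight capacity (select h F)) tight))
    where
    sat : MatchingSat d (select g F)
    sat = Equivalence.from (MatchingSat⇔Matching (select g F)) matching
    δ-h≤δ* : + length (select h F) - + weight capacity (select h F) ℤ.≤ δ* d F
    δ-h≤δ* = subst (ℤ._≤ δ* d F) (δ-select h) (δ-select-≤-δ* d F h)

  maximumMatchingSat : ∃[ F′ ] (_≤ₘ_ d F′ F × MatchingSat d F′ × + c d F′ ≡ + c d F - δ* d F)
  maximumMatchingSat with maximumMatchingSat-select
  ... | g , sat , size = select g F , (select g F , select-⊆ g F , ↭-refl) , sat , size

  matchingSat⇒δ*≡0 : MatchingSat d F → δ* d F ≡ + 0
  matchingSat⇒δ*≡0 sat with δ*-attained d F
  ... | h , δ*≡ = ℤ.≤-antisym (subst (ℤ._≤ + 0) (sym (trans δ*≡ (δ-select h))) (ℤ.i≤j⇒i-j≤0 (+≤+ h≤weight))) (δ*-nonneg d F)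
    where
    h≤weight : length (select h F) ≤ weight capacity (select h F)
    h≤weight = ℕ.+-cancelˡ-≤ (length F) _ _ (matchingSat-bound (F , Sublist.⊆-refl , ↭-refl) sat h)

  δ*≡0⇒matchingSat : δ* d F ≡ + 0 → MatchingSat d F
  δ*≡0⇒matchingSat δ*≡0 with maximumMatchingSat-select
  ... | g , sat , size = subst (MatchingSat d) (select-complete g F (ℤ.+-injective complete)) sat
    where
    complete : + length (select g F) ≡ + length F
    complete = trans size (trans (cong (+ length F -_) δ*≡0) (ℤ.+-identityʳ (+ length F)))

lemma1p7p2 : (d : ℕ → ℕ) → (∀ v → 0 < d v) → (F : MCS d) →
    ((∃[ F' ] (_≤ₘ_ d F' F × MatchingSat d F' × + c d F' ≡ + c d F - δ* d F))
      × (∀ F' → _≤ₘ_ d F' F → MatchingSat d F' → (+ c d F') ℤ.≤ (+ c d F - δ* d F)))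
    × (MatchingSat d F ⇔ δ* d F ≡ + 0)
lemma1p7p2 d d-pos F = (maximumMatchingSat , matchingSat-≤) , mk⇔ matchingSat⇒δ*≡0 δ*≡0⇒matchingSat
  where open MatchingDeficiency d d-pos F
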